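{- Let $(B,\cdot,\circ)$ be a skew left brace and let $(B,\lambda,\rho)$ be its associated solution. The following are equivalent: (i) $(B,\lambda,\rho)$ is $2$-reductive; (ii) $\lambda_{a\cdot b}=\lambda_{b\cdot a}=\lambda_{a\circ b}$ and $\rho_{a\cdot b}=\rho_{b\cdot a}=\rho_{a\circ b}$ for all $a,b\in B$; (iii) $(B,\lambda,\rho)$ is of multipermutation level at most $2$; (iv) $(B,\cdot,\circ)$ is nilpotent of class at most $2$; (v) the opposite skew left brace $(B,\cdot_{op},\circ)$ is nilpotent of class at most $2$.
   Context: A skew left brace is $(B,\cdot,\circ)$ with $(B,\cdot)$ and $(B,\circ)$ groups such that $a\circ(b\cdot c)=(a\circ b)\cdot a^{ -1}\cdot(a\circ c)$ for all $a,b,c$; $a^{ -1}$ is the inverse in $(B,\cdot)$, $\bar a$ the inverse in $(B,\circ)$ (both groups share the neutral element $1$). Put $\lambda_a(b)=a^{ -1}\cdot(a\circ b)$ and $\rho_b(a)=\overline{\lambda_a(b)}\circ a\circ b$; the associated solution is $(B,\lambda,\rho)$, i.e. $r(a,b)=(\lambda_a(b),\rho_b(a))$, which is a solution. A solution is a triple $(X,\sigma,\tau)$ with bijections $\sigma_x,\tau_y$ of $X$ such that $r(x,y)=(\sigma_x(y),\tau_y(x))$ is a bijection of $X^2$ satisfying $(\mathrm{id}\times r)(r\times\mathrm{id})(\mathrm{id}\times r)=(r\times\mathrm{id})(\mathrm{id}\times r)(r\times\mathrm{id})$. It is $2$-reductive if $\sigma_{\sigma_x(y)}=\sigma_y$,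 $\tau_{\tau_x(y)}=\tau_y$, $\sigma_{\tau_x(y)}=\sigma_y$, $\tau_{\sigma_x(y)}=\tau_y$ for all $x,y$. For a solution, $x\approx y$ iff $\sigma_x=\sigma_y$ and $\tau_x=\tau_y$; this is a congruence and induces the retraction solution $\mathrm{Ret}(X)$ on $X/{\approx}$ by $\sigma_{[x]}([y])=[\sigma_x(y)]$, $\tau_{[y]}([x])=[\tau_y(x)]$. The solution has multipermutation level at most $2$ if $\mathrm{Ret}(\mathrm{Ret}(X))$ has one element. The socle is $\mathrm{Soc}(B)=\{a\in B: a\circ b=a\cdot b=b\cdot a\ \forall b\in B\}$, an ideal (normal in both groups and $\lambda$-invariant), so $B/\mathrm{Soc}(B)$ is a skew left brace; with $B_0=B$, $B_{n+1}=B_n/\mathrm{Soc}(B_n)$, $B$ is nilpotent of class at most $2$ if $|B_2|=1$. The opposite skew left brace is $(B,\cdot_{op},\circ)$ with $a\cdot_{op}b=b\cdot a$. -}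

module Defs where

open import Level using (Level)
open import Data.Nat using (ℕ; zero; suc)
open import Data.Product using (_×_; _,_; proj₁; proj₂)
open import Relation.Binary.Core using (Rel)
open import Relation.Binary.PropositionalEquality
  using (_≡_; refl; sym; trans; cong; cong₂; isEquivalence)
open import Algebra.Structures using (IsGroup)

record SkewBrace (ℓ : Level) : Set (Level.suc ℓ) where
  infixl 7 _·_
  infixl 7 _∘_
  field
    Carrier : Set ℓ
    _·_     : Carrier → Carrier → Carrier
    _∘_     : Carrier → Carrier → Carrier
    e       : Carrier
    _⁻¹     : Carrier → Carrier
    bar     : Carrier → Carrier
    ·-isGroup : IsGroup _≡_ _·_ e _⁻¹
    ∘-isGroup : IsGroup _≡_ _∘_ e bar
    brace   : ∀ a b c → a ∘ (b · c) ≡ ((a ∘ b) · (a ⁻¹)) · (a ∘ c)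

opposite : ∀ {ℓ} → SkewBrace ℓ → SkewBrace ℓ
opposite B = record
  { Carrier = Carrier
  ; _·_ = λ a b → b · a
  ; _∘_ = _∘_
  ; e = e
  ; _⁻¹ = _⁻¹
  ; bar = bar
  ; ·-isGroup = opG
  ; ∘-isGroup = ∘-isGroup
  ; brace = λ a b c → trans (brace a c b) (G.assoc (a ∘ c) (a ⁻¹) (a ∘ b))
  }
  where
  open SkewBrace B
  module G = IsGroup ·-isGroup
  opG : IsGroup _≡_ (λ a b → b · a) e _⁻¹
  opG = record
    { isMonoid = record
      { isSemigroup = record
        { isMagma = record
          { isEquivalence = isEquivalence
          ; ∙-cong = λ p q → cong₂ (λ a b → b · a) p q }
        ; assoc = λ x y z → sym (G.assoc z y x) }
      ; identity = (λ x → proj₂ G.identity x) , (λ x → proj₁ G.identity x) }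
    ; inverse = (λ x → proj₂ G.inverse x) , (λ x → proj₁ G.inverse x)
    ; ⁻¹-cong = G.⁻¹-cong }

-- Solutions given by maps σ, τ : X → X → X, r(x,y) = (σ x y , τ y x)

module _ {ℓ : Level} {X : Set ℓ} (σ τ : X → X → X) where

  TwoReductive : Set ℓ
  TwoReductive =
    (∀ x y z → σ (σ x y) z ≡ σ y z) ×
    (∀ x y z → τ (τ x y) z ≡ τ y z) ×
    (∀ x y z → σ (τ x y) z ≡ σ y z) ×
    (∀ x y z → τ (σ x y) z ≡ τ y z)

  -- RetRel n is the equality of Ret^n(X), represented on X:
  -- RetRel 0 is equality on X, and [x] = [y] in Ret^{n+1}(X) iff
  -- σ_[x] = σ_[y] and τ_[x] = τ_[y] as maps of Ret^n(X).
  RetRel : ℕ → Rel X ℓ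
  RetRel zero      = _≡_
  RetRel (suc n) x y = ∀ z → RetRel n (σ x z) (σ y z) × RetRel n (τ x z) (τ y z)

  -- multipermutation level at most 2: Ret(Ret(X)) has exactly one element
  -- (X is inhabited by 1 in our application, so "at most one" suffices)
  MPL≤2 : Set ℓ
  MPL≤2 = ∀ x y → RetRel 2 x y

module _ {ℓ : Level} (B : SkewBrace ℓ) where
  open SkewBrace B

  lam : Carrier → Carrier → Carrier
  lam a b = (a ⁻¹) · (a ∘ b)

  rho : Carrier → Carrier → Carrier
  rho b a = (bar (lam a b) ∘ a) ∘ b

  -- membership in the socle of a quotient brace whose equality is R
  InSoc : Rel Carrier ℓ → Carrier → Set ℓ
  InSoc R a = ∀ b → R (a ∘ b) (a · b) × R (a · b) (b · a)

  -- QRel n is the equality of B_n represented on B: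
  -- B_0 = B, and in B_{n+1} = B_n / Soc(B_n) we have [a] = [b] iff
  -- a⁻¹ · b ∈ Soc(B_n) (operations of B_n are induced from B).
  QRel : ℕ → Rel Carrier ℓ
  QRel zero      = _≡_
  QRel (suc n) a b = InSoc (QRel n) ((a ⁻¹) · b)

  -- nilpotent of class at most 2: |B_2| = 1
  NilpotentClass≤2 : Set ℓ
  NilpotentClass≤2 = ∀ a b → QRel 2 a b

  ConditionII : Set ℓ
  ConditionII = ∀ a b →
    (∀ c → lam (a · b) c ≡ lam (b · a) c) ×
    (∀ c → lam (b · a) c ≡ lam (a ∘ b) c) ×
    (∀ c → rho (a · b) c ≡ rho (b · a) c) ×
    (∀ c → rho (b · a) c ≡ rho (a ∘ b) c)

{-# OPTIONS --safe #-}
module Submission where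

open import Defs
open import Level using (Level)
open import Data.Product using (_×_; _,_; proj₁; proj₂)
open import Function.Bundles using (_⇔_; mk⇔; module Equivalence)
open import Function.Construct.Composition using (_⇔-∘_)
open import Function.Construct.Symmetry using (⇔-sym)
open import Relation.Binary.Core using (Rel)
open import Relation.Binary.PropositionalEquality
  using (_≡_; sym; trans; cong; cong₂; subst; module ≡-Reasoning)
open import Algebra.Bundles using (Group)
open import Algebra.Structures using (IsGroup)
import Algebra.Properties.Group as GroupProperties

open Equivalence using (to; from)

-- Idea: the retraction congruence of the associated solution has the cosets
-- of Soc(B) as classes, so Ret(B) is a solution on B/Soc(B), and each of the
-- five conditions says, directly or through this identification, that all of
-- B/Soc(B) lies in its own socle.  The key formula is
-- λ_{λ_a(b)}(ρ_b(a)) = λ_a(b)⁻¹ a λ_a(b), which turns ρ into conjugation.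

module GroupLemmas {a} {A : Set a} {mul : A → A → A} {ε : A} {inv : A → A}
                   (isGroup : IsGroup _≡_ mul ε inv) where

  group : Group a a
  group = record { isGroup = isGroup }

  open Group group public using (_∙_; _⁻¹; assoc; identityˡ; identityʳ; inverseˡ; inverseʳ)
  open GroupProperties group public
  open ≡-Reasoning

  infixr 8 _^_

  _^_ : A → A → A
  x ^ y = y ⁻¹ ∙ (x ∙ y)

  ^-∙ : ∀ x y z → x ^ (y ∙ z) ≡ (x ^ y) ^ z
  ^-∙ x y z = begin
    (y ∙ z) ⁻¹ ∙ (x ∙ (y ∙ z))    ≡⟨ cong₂ _∙_ (⁻¹-anti-homo-∙ y z) (sym (assoc x y z)) ⟩
    (z ⁻¹ ∙ y ⁻¹) ∙ ((x ∙ y) ∙ z)  ≡⟨ assoc (z ⁻¹) (y ⁻¹) _ ⟩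
    z ⁻¹ ∙ (y ⁻¹ ∙ ((x ∙ y) ∙ z))  ≡⟨ cong (z ⁻¹ ∙_) (sym (assoc (y ⁻¹) (x ∙ y) z)) ⟩
    z ⁻¹ ∙ ((y ⁻¹ ∙ (x ∙ y)) ∙ z)  ∎

  ^-cancelʳ : ∀ x y z → x ^ z ≡ y ^ z → x ≡ y
  ^-cancelʳ x y z eq = ∙-cancelʳ z x y (∙-cancelˡ (z ⁻¹) (x ∙ z) (y ∙ z) eq)

  ^-fixed⇒comm : ∀ x y → x ^ y ≡ x → x ∙ y ≡ y ∙ x
  ^-fixed⇒comm x y eq = trans (sym (\\-leftDividesˡ y (x ∙ y))) (cong (y ∙_) eq)

  comm⇒^-fixed : ∀ x y → x ∙ y ≡ y ∙ x → x ^ y ≡ x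
  comm⇒^-fixed x y eq = trans (cong (y ⁻¹ ∙_) eq) (\\-leftDividesʳ y x)

  ^-commutator : ∀ x y → (x ^ y) ⁻¹ ∙ x ≡ (x ∙ y) ⁻¹ ∙ (y ∙ x)
  ^-commutator x y = trans (cong (_∙ x) (⁻¹-anti-homo-\\ y (x ∙ y))) (assoc _ y x)

  ∙-comm-from-right : ∀ x y → (y ∙ x) ∙ x ≡ x ∙ (y ∙ x) → x ∙ y ≡ y ∙ x
  ∙-comm-from-right x y eq = ∙-cancelʳ x (x ∙ y) (y ∙ x) (trans (assoc x y x) (sym eq))

  Central : A → Set a
  Central s = ∀ d → s ∙ d ≡ d ∙ s

  central-∙ : ∀ {s t} → Central s → Central t → Central (s ∙ t)
  central-∙ {s} {t} hs ht d = begin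
    (s ∙ t) ∙ d  ≡⟨ assoc s t d ⟩
    s ∙ (t ∙ d)  ≡⟨ cong (s ∙_) (ht d) ⟩
    s ∙ (d ∙ t)  ≡⟨ sym (assoc s d t) ⟩
    (s ∙ d) ∙ t  ≡⟨ cong (_∙ t) (hs d) ⟩
    (d ∙ s) ∙ t  ≡⟨ assoc d s t ⟩
    d ∙ (s ∙ t)  ∎

  central-⁻¹ : ∀ {s} → Central s → Central (s ⁻¹)
  central-⁻¹ {s} hs d = begin
    s ⁻¹ ∙ d                  ≡⟨ cong (s ⁻¹ ∙_) (sym (//-rightDividesˡ s d)) ⟩
    s ⁻¹ ∙ ((d ∙ s ⁻¹) ∙ s)   ≡⟨ cong (s ⁻¹ ∙_) (sym (hs _)) ⟩
    s ⁻¹ ∙ (s ∙ (d ∙ s ⁻¹))   ≡⟨ \\-leftDividesʳ s _ ⟩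
    d ∙ s ⁻¹                  ∎

module _ {ℓ : Level} {X : Set ℓ} (σ τ : X → X → X) where

  RetRel₁-sym : ∀ {x y} → RetRel σ τ 1 x y → RetRel σ τ 1 y x
  RetRel₁-sym h z = sym (proj₁ (h z)) , sym (proj₂ (h z))

  RetRel₁-trans : ∀ {x y w} → RetRel σ τ 1 x y → RetRel σ τ 1 y w → RetRel σ τ 1 x w
  RetRel₁-trans h k z = trans (proj₁ (h z)) (proj₁ (k z)) , trans (proj₂ (h z)) (proj₂ (k z))

  -- Ret(X) is the trivial solution: σ_[x] = τ_[x] = id.
  TrivialRetraction : Set ℓ
  TrivialRetraction = ∀ x y → RetRel σ τ 1 (σ x y) y × RetRel σ τ 1 (τ x y) y

  twoReductive⇔trivialRetraction : TwoReductive σ τ ⇔ TrivialRetraction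
  twoReductive⇔trivialRetraction = mk⇔
    (λ (σσ , ττ , στ , τσ) x y → (λ z → σσ x y z , τσ x y z) , (λ z → στ x y z , ττ x y z))
    (λ t → (λ x y z → proj₁ (proj₁ (t x y) z)) , (λ x y z → proj₂ (proj₂ (t x y) z)) ,
           (λ x y z → proj₁ (proj₂ (t x y) z)) , (λ x y z → proj₂ (proj₁ (t x y) z)))

  mpl≤2⇔trivialRetraction : ∀ e → (∀ y → σ e y ≡ y) → (∀ y → τ e y ≡ y) →
                            MPL≤2 σ τ ⇔ TrivialRetraction
  mpl≤2⇔trivialRetraction e σ-e τ-e = mk⇔
    (λ m x y → subst (RetRel σ τ 1 (σ x y)) (σ-e y) (proj₁ (m x e y)) ,
               subst (RetRel σ τ 1 (τ x y)) (τ-e y) (proj₂ (m x e y)))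
    (λ t x x′ y → RetRel₁-trans (proj₁ (t x y)) (RetRel₁-sym (proj₁ (t x′ y))) ,
                  RetRel₁-trans (proj₂ (t x y)) (RetRel₁-sym (proj₂ (t x′ y))))

nilpotent≤2⇔ : ∀ {ℓ} (B : SkewBrace ℓ) → NilpotentClass≤2 B ⇔ (∀ x → InSoc B (QRel B 1) x)
nilpotent≤2⇔ B = mk⇔
  (λ n x → subst (InSoc B (QRel B 1)) (trans (cong (_· x) G.ε⁻¹≈ε) (G.identityˡ x)) (n e x))
  (λ soc a b → soc (a ⁻¹ · b))
  where
  open SkewBrace B
  module G = GroupLemmas ·-isGroup

module Brace {ℓ : Level} (B : SkewBrace ℓ) where
  open SkewBrace B
  module G = GroupLemmas ·-isGroup
  module C = GroupLemmas ∘-isGroup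
  open G using (_^_; Central)
  open ≡-Reasoning

  σ τ : Carrier → Carrier → Carrier
  σ = lam B
  τ = rho B

  ∘-as-· : ∀ a b → a ∘ b ≡ a · σ a b
  ∘-as-· a b = sym (G.\\-leftDividesˡ a (a ∘ b))

  σ-· : ∀ a b c → σ a (b · c) ≡ σ a b · σ a c
  σ-· a b c = begin
    a ⁻¹ · (a ∘ (b · c))                   ≡⟨ cong (a ⁻¹ ·_) (brace a b c) ⟩
    a ⁻¹ · (((a ∘ b) · a ⁻¹) · (a ∘ c))   ≡⟨ sym (G.assoc _ _ _) ⟩
    (a ⁻¹ · ((a ∘ b) · a ⁻¹)) · (a ∘ c)   ≡⟨ cong (_· (a ∘ c)) (sym (G.assoc _ _ _)) ⟩
    ((a ⁻¹ · (a ∘ b)) · a ⁻¹) · (a ∘ c)   ≡⟨ G.assoc _ _ _ ⟩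
    (a ⁻¹ · (a ∘ b)) · (a ⁻¹ · (a ∘ c))   ∎

  σ-∘ : ∀ a b c → σ (a ∘ b) c ≡ σ a (σ b c)
  σ-∘ a b c = trans (cong ((a ∘ b) ⁻¹ ·_) split) (G.\\-leftDividesʳ (a ∘ b) _)
    where
    split : (a ∘ b) ∘ c ≡ (a ∘ b) · σ a (σ b c)
    split = begin
      (a ∘ b) ∘ c                          ≡⟨ C.assoc a b c ⟩
      a ∘ (b ∘ c)                          ≡⟨ cong (a ∘_) (∘-as-· b c) ⟩
      a ∘ (b · σ b c)                      ≡⟨ brace a b (σ b c) ⟩
      ((a ∘ b) · a ⁻¹) · (a ∘ σ b c)       ≡⟨ G.assoc _ _ _ ⟩
      (a ∘ b) · σ a (σ b c)                ∎

  σ-e : ∀ c → σ e c ≡ c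
  σ-e c = trans (cong₂ _·_ G.ε⁻¹≈ε (C.identityˡ c)) (G.identityˡ c)

  σ-fix-e : ∀ a → σ a e ≡ e
  σ-fix-e a = trans (cong (a ⁻¹ ·_) (C.identityʳ a)) (G.inverseˡ a)

  σ-bar-σ : ∀ a c → σ (bar a) (σ a c) ≡ c
  σ-bar-σ a c = trans (sym (σ-∘ (bar a) a c)) (trans (cong (λ x → σ x c) (C.inverseˡ a)) (σ-e c))

  σ-σ-bar : ∀ a c → σ a (σ (bar a) c) ≡ c
  σ-σ-bar a c = trans (sym (σ-∘ a (bar a) c)) (trans (cong (λ x → σ x c) (C.inverseʳ a)) (σ-e c))

  σ-injective : ∀ a {x y} → σ a x ≡ σ a y → x ≡ y
  σ-injective a {x} {y} p = trans (sym (σ-bar-σ a x)) (trans (cong (σ (bar a)) p) (σ-bar-σ a y))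

  σ-bar-self : ∀ a → σ a (bar a) ≡ a ⁻¹
  σ-bar-self a = trans (cong (a ⁻¹ ·_) (C.inverseʳ a)) (G.identityʳ _)

  τ-e : ∀ a → τ e a ≡ a
  τ-e a = begin
    (bar (σ a e) ∘ a) ∘ e  ≡⟨ C.identityʳ _ ⟩
    bar (σ a e) ∘ a        ≡⟨ cong (λ x → bar x ∘ a) (σ-fix-e a) ⟩
    bar e ∘ a              ≡⟨ cong (_∘ a) C.ε⁻¹≈ε ⟩
    e ∘ a                  ≡⟨ C.identityˡ a ⟩
    a                      ∎

  σ∘τ : ∀ a b → σ a b ∘ τ b a ≡ a ∘ b
  σ∘τ a b = trans (sym (C.assoc _ _ b)) (cong (_∘ b) (C.\\-leftDividesˡ (σ a b) a))

  σ-σ-τ : ∀ a b z → σ (σ a b) (σ (τ b a) z) ≡ σ a (σ b z)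
  σ-σ-τ a b z = trans (sym (σ-∘ _ _ z)) (trans (cong (λ x → σ x z) (σ∘τ a b)) (σ-∘ a b z))

  σ-τ : ∀ a b → σ (σ a b) (τ b a) ≡ a ^ σ a b
  σ-τ a b = cong ((σ a b) ⁻¹ ·_) (trans (σ∘τ a b) (∘-as-· a b))

  σ-central : ∀ a {s} → Central s → Central (σ a s)
  σ-central a {s} hs d = begin
    σ a s · d                    ≡⟨ cong (σ a s ·_) (sym (σ-σ-bar a d)) ⟩
    σ a s · σ a (σ (bar a) d)    ≡⟨ sym (σ-· a s _) ⟩
    σ a (s · σ (bar a) d)        ≡⟨ cong (σ a) (hs _) ⟩
    σ a (σ (bar a) d · s)        ≡⟨ σ-· a _ s ⟩
    σ a (σ (bar a) d) · σ a s    ≡⟨ cong (_· σ a s) (σ-σ-bar a d) ⟩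
    d · σ a s                    ∎

  central-of-σ-comm : ∀ x → (∀ a → σ a x · a ≡ a · σ a x) → Central x
  central-of-σ-comm x h g = begin
    x · g                                   ≡⟨ cong₂ _·_ (sym (σ-σ-bar c x)) (sym c⁻¹≡g) ⟩
    σ c (σ (bar c) x) · σ c (bar c)         ≡⟨ sym (σ-· c _ _) ⟩
    σ c (σ (bar c) x · bar c)               ≡⟨ cong (σ c) (h (bar c)) ⟩
    σ c (bar c · σ (bar c) x)               ≡⟨ σ-· c _ _ ⟩
    σ c (bar c) · σ c (σ (bar c) x)         ≡⟨ cong₂ _·_ c⁻¹≡g (σ-σ-bar c x) ⟩
    g · x                                   ∎
    where
    c = g ⁻¹
    c⁻¹≡g : σ c (bar c) ≡ g
    c⁻¹≡g = trans (σ-bar-self c) (G.⁻¹-involutive g)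

  Soc : Carrier → Set ℓ
  Soc = InSoc B _≡_

  soc⇒σ-id : ∀ {s} → Soc s → ∀ d → σ s d ≡ d
  soc⇒σ-id {s} h d = trans (cong (s ⁻¹ ·_) (proj₁ (h d))) (G.\\-leftDividesʳ s d)

  soc⇒central : ∀ {s} → Soc s → Central s
  soc⇒central h d = proj₂ (h d)

  mkSoc : ∀ {s} → (∀ d → σ s d ≡ d) → Central s → Soc s
  mkSoc {s} f g d = trans (∘-as-· s d) (cong (s ·_) (f d)) , g d

  soc-σ-· : ∀ {s} → Soc s → ∀ w z → σ (s · w) z ≡ σ w z
  soc-σ-· {s} h w z = begin
    σ (s · w) z    ≡⟨ cong (λ x → σ x z) (sym (proj₁ (h w))) ⟩
    σ (s ∘ w) z    ≡⟨ σ-∘ s w z ⟩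
    σ s (σ w z)    ≡⟨ soc⇒σ-id h _ ⟩
    σ w z          ∎

  soc-· : ∀ {s t} → Soc s → Soc t → Soc (s · t)
  soc-· {s} {t} hs ht =
    mkSoc (λ d → trans (soc-σ-· hs t d) (soc⇒σ-id ht d))
          (G.central-∙ (soc⇒central hs) (soc⇒central ht))

  soc-⁻¹ : ∀ {s} → Soc s → Soc (s ⁻¹)
  soc-⁻¹ {s} h = mkSoc σ-id (G.central-⁻¹ (soc⇒central h))
    where
    σ-id : ∀ d → σ (s ⁻¹) d ≡ d
    σ-id d = trans (sym (soc-σ-· h (s ⁻¹) d))
                   (trans (cong (λ x → σ x d) (G.inverseʳ s)) (σ-e d))

  -- For t = λ_a(s), the element (a ∘ s) ∘ ā acts trivially and agrees with t
  -- after multiplying by a.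
  soc-σ : ∀ {s} → Soc s → ∀ a → Soc (σ a s)
  soc-σ {s} hs a = mkSoc σ-id t-central
    where
    t = σ a s
    t-central : Central t
    t-central = σ-central a (soc⇒central hs)
    w = (a ∘ s) ∘ bar a
    σw-id : ∀ d → σ w d ≡ d
    σw-id d = begin
      σ w d                      ≡⟨ σ-∘ (a ∘ s) (bar a) d ⟩
      σ (a ∘ s) (σ (bar a) d)    ≡⟨ σ-∘ a s _ ⟩
      σ a (σ s (σ (bar a) d))    ≡⟨ cong (σ a) (soc⇒σ-id hs _) ⟩
      σ a (σ (bar a) d)          ≡⟨ σ-σ-bar a d ⟩
      d                          ∎
    wa≡ta : w · a ≡ t · a
    wa≡ta = begin
      w · a         ≡⟨ cong (w ·_) (sym (σw-id a)) ⟩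
      w · σ w a     ≡⟨ sym (∘-as-· w a) ⟩
      w ∘ a         ≡⟨ C.//-rightDividesˡ a (a ∘ s) ⟩
      a ∘ s         ≡⟨ ∘-as-· a s ⟩
      a · t         ≡⟨ sym (t-central a) ⟩
      t · a         ∎
    σ-id : ∀ d → σ t d ≡ d
    σ-id d = trans (cong (λ x → σ x d) (sym (G.∙-cancelʳ a w t wa≡ta))) (σw-id d)

  soc-swap : ∀ x y → Soc (y · x) → Soc (x · y)
  soc-swap x y h = subst Soc (sym (G.∙-comm-from-right x y (soc⇒central h x))) h

  infix 4 _~_

  _~_ : Rel Carrier ℓ
  _~_ = QRel B 1

  ~-sym : ∀ {u v} → u ~ v → v ~ u
  ~-sym {u} {v} h = subst Soc (G.⁻¹-anti-homo-\\ u v) (soc-⁻¹ h)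

  ~-trans : ∀ {u v w} → u ~ v → v ~ w → u ~ w
  ~-trans {u} {v} {w} h k = subst Soc
    (trans (G.assoc (u ⁻¹) v (v ⁻¹ · w)) (cong (u ⁻¹ ·_) (G.\\-leftDividesˡ v w)))
    (soc-· h k)

  ~⇒RetRel₁ : ∀ {u v} → u ~ v → RetRel σ τ 1 u v
  ~⇒RetRel₁ {u} {v} h z = sym (σ-v z) , sym (τ-v z)
    where
    s = u ⁻¹ · v
    v≡s·u : v ≡ s · u
    v≡s·u = trans (sym (G.\\-leftDividesˡ u v)) (sym (soc⇒central h u))
    σ-v : ∀ z → σ v z ≡ σ u z
    σ-v z = trans (cong (λ x → σ x z) v≡s·u) (soc-σ-· h u z)
    τ-v : ∀ a → τ v a ≡ τ u a
    τ-v a = σ-injective y (begin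
      σ y (τ v a)            ≡⟨ sym (soc-σ-· ht y _) ⟩
      σ (t · y) (τ v a)      ≡⟨ cong (λ x → σ x (τ v a)) (sym σav) ⟩
      σ (σ a v) (τ v a)      ≡⟨ σ-τ a v ⟩
      a ^ σ a v              ≡⟨ cong (a ^_) σav ⟩
      a ^ (t · y)            ≡⟨ G.^-∙ a t y ⟩
      (a ^ t) ^ y            ≡⟨ cong (_^ y) (G.comm⇒^-fixed a t (sym (soc⇒central ht a))) ⟩
      a ^ y                  ≡⟨ sym (σ-τ a u) ⟩
      σ y (τ u a)            ∎)
      where
      t = σ a s
      ht : Soc t
      ht = soc-σ h a
      y = σ a u
      σav : σ a v ≡ t · y
      σav = trans (cong (σ a) v≡s·u) (σ-· a s u)

  RetRel₁⇒σ-σ : ∀ {u v} → RetRel σ τ 1 u v → ∀ a z → σ (σ a u) z ≡ σ (σ a v) z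
  RetRel₁⇒σ-σ {u} {v} h a z = begin
    σ (σ a u) z                      ≡⟨ cong (σ (σ a u)) (sym (σ-σ-bar (τ u a) z)) ⟩
    σ (σ a u) (σ (τ u a) z′)         ≡⟨ σ-σ-τ a u z′ ⟩
    σ a (σ u z′)                     ≡⟨ cong (σ a) (proj₁ (h z′)) ⟩
    σ a (σ v z′)                     ≡⟨ sym (σ-σ-τ a v z′) ⟩
    σ (σ a v) (σ (τ v a) z′)         ≡⟨ cong (λ b → σ (σ a v) (σ b z′)) (sym (proj₂ (h a))) ⟩
    σ (σ a v) (σ (τ u a) z′)         ≡⟨ cong (σ (σ a v)) (σ-σ-bar (τ u a) z) ⟩
    σ (σ a v) z                      ∎
    where z′ = σ (bar (τ u a)) z

  RetRel₁⇒σ-comm : ∀ {u v} → RetRel σ τ 1 u v → ∀ a → σ a (v · u ⁻¹) · a ≡ a · σ a (v · u ⁻¹)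
  RetRel₁⇒σ-comm {u} {v} h a = sym (G.^-fixed⇒comm a t (G.^-cancelʳ (a ^ t) a y (begin
    (a ^ t) ^ y           ≡⟨ sym (G.^-∙ a t y) ⟩
    a ^ (t · y)           ≡⟨ cong (a ^_) (sym σav) ⟩
    a ^ σ a v             ≡⟨ sym (σ-τ a v) ⟩
    σ (σ a v) (τ v a)     ≡⟨ sym (RetRel₁⇒σ-σ h a (τ v a)) ⟩
    σ y (τ v a)           ≡⟨ cong (σ y) (sym (proj₂ (h a))) ⟩
    σ y (τ u a)           ≡⟨ σ-τ a u ⟩
    a ^ y                 ∎)))
    where
    t = σ a (v · u ⁻¹)
    y = σ a u
    σav : σ a v ≡ t · y
    σav = trans (cong (σ a) (sym (G.//-rightDividesˡ u v))) (σ-· a _ u)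

  -- ρ_u = ρ_v makes λ_a(x) commute with every a, so x = v · u⁻¹ is central;
  -- then λ_u = λ_v makes w = λ_ū(x) act trivially, so w ∈ Soc(B) and
  -- x = λ_u(w) ∈ Soc(B).
  RetRel₁⇒~ : ∀ {u v} → RetRel σ τ 1 u v → u ~ v
  RetRel₁⇒~ {u} {v} h = soc-swap (u ⁻¹) v (subst Soc (σ-σ-bar u x) (soc-σ soc-w u))
    where
    x = v · u ⁻¹
    x-central : Central x
    x-central = central-of-σ-comm x (RetRel₁⇒σ-comm h)
    w = σ (bar u) x
    u∘w≡v : u ∘ w ≡ v
    u∘w≡v = begin
      u ∘ w       ≡⟨ ∘-as-· u w ⟩
      u · σ u w   ≡⟨ cong (u ·_) (σ-σ-bar u x) ⟩
      u · x       ≡⟨ sym (x-central u) ⟩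
      x · u       ≡⟨ G.//-rightDividesˡ u v ⟩
      v           ∎
    σ-w-id : ∀ z → σ w z ≡ z
    σ-w-id z = σ-injective u (begin
      σ u (σ w z)      ≡⟨ sym (σ-∘ u w z) ⟩
      σ (u ∘ w) z      ≡⟨ cong (λ b → σ b z) u∘w≡v ⟩
      σ v z            ≡⟨ sym (proj₁ (h z)) ⟩
      σ u z            ∎)
    soc-w : Soc w
    soc-w = mkSoc σ-w-id (σ-central (bar u) x-central)

  ∘-·-quotient : ∀ x c → (x ∘ c) ⁻¹ · (x · c) ≡ (σ x c) ⁻¹ · c
  ∘-·-quotient x c = begin
    (x ∘ c) ⁻¹ · (x · c)              ≡⟨ cong (λ t → t ⁻¹ · (x · c)) (∘-as-· x c) ⟩
    (x · σ x c) ⁻¹ · (x · c)          ≡⟨ cong (_· (x · c)) (G.⁻¹-anti-homo-∙ x _) ⟩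
    ((σ x c) ⁻¹ · x ⁻¹) · (x · c)     ≡⟨ G.assoc _ _ _ ⟩
    (σ x c) ⁻¹ · (x ⁻¹ · (x · c))     ≡⟨ cong ((σ x c) ⁻¹ ·_) (G.\\-leftDividesʳ x c) ⟩
    (σ x c) ⁻¹ · c                    ∎

  τ~conj : (∀ x z → σ x z ~ z) → ∀ x z → τ x z ~ z ^ σ z x
  τ~conj Λ x z = subst (_~ z ^ y) τ≡ (Λ (bar y) (z ^ y))
    where
    y = σ z x
    τ≡ : σ (bar y) (z ^ y) ≡ τ x z
    τ≡ = trans (cong (σ (bar y)) (sym (σ-τ z x))) (σ-bar-σ y (τ x z))

  trivialRetraction⇔ : TrivialRetraction σ τ ⇔ (∀ x → InSoc B _~_ x)
  trivialRetraction⇔ = mk⇔ to-soc from-soc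
    where
    to-soc : TrivialRetraction σ τ → ∀ x → InSoc B _~_ x
    to-soc t x c = subst Soc (sym (∘-·-quotient x c)) (Λ x c) ,
                   subst Soc (G.^-commutator x c) x^c~x
      where
      Λ : ∀ x z → σ x z ~ z
      Λ x z = RetRel₁⇒~ (proj₁ (t x z))
      x₀ = σ (bar x) c
      x^c~x : x ^ c ~ x
      x^c~x = subst (λ y → x ^ y ~ x) (σ-σ-bar x c)
                    (~-trans (~-sym (τ~conj Λ x₀ x)) (RetRel₁⇒~ (proj₂ (t x₀ x))))
    from-soc : (∀ x → InSoc B _~_ x) → TrivialRetraction σ τ
    from-soc soc x z = ~⇒RetRel₁ (Λ x z) ,
                       ~⇒RetRel₁ (~-trans (τ~conj Λ x z)
                         (subst Soc (sym (G.^-commutator z (σ z x))) (proj₂ (soc z (σ z x)))))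
      where
      Λ : ∀ x z → σ x z ~ z
      Λ x c = subst Soc (∘-·-quotient x c) (proj₁ (soc x c))

  conditionII⇔ : ConditionII B ⇔ (∀ x → InSoc B _~_ x)
  conditionII⇔ = mk⇔ to-soc from-soc
    where
    to-soc : ConditionII B → ∀ x → InSoc B _~_ x
    to-soc cII a b = ~-sym (~-trans ab~ba ba~a∘b) , ab~ba
      where
      ab~ba : a · b ~ b · a
      ab~ba = RetRel₁⇒~ (λ z → proj₁ (cII a b) z , proj₁ (proj₂ (proj₂ (cII a b))) z)
      ba~a∘b : b · a ~ a ∘ b
      ba~a∘b = RetRel₁⇒~ (λ z → proj₁ (proj₂ (cII a b)) z , proj₂ (proj₂ (proj₂ (cII a b))) z)
    from-soc : (∀ x → InSoc B _~_ x) → ConditionII B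
    from-soc soc a b = (λ c → proj₁ (ab≈ba c)) , (λ c → proj₁ (ba≈a∘b c)) ,
                       (λ c → proj₂ (ab≈ba c)) , (λ c → proj₂ (ba≈a∘b c))
      where
      a∘b~ab : a ∘ b ~ a · b
      a∘b~ab = proj₁ (soc a b)
      ab~ba : a · b ~ b · a
      ab~ba = proj₂ (soc a b)
      ab≈ba : RetRel σ τ 1 (a · b) (b · a)
      ab≈ba = ~⇒RetRel₁ ab~ba
      ba≈a∘b : RetRel σ τ 1 (b · a) (a ∘ b)
      ba≈a∘b = ~⇒RetRel₁ (~-sym (~-trans a∘b~ab ab~ba))

  -- In the opposite brace a ⁻¹ ·op b = b · a ⁻¹, and its socle is Soc(B).
  opposite-~⇔ : ∀ {u v} → QRel (opposite B) 1 u v ⇔ u ~ v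
  opposite-~⇔ {u} {v} = mk⇔
    (λ h → soc-swap (u ⁻¹) v (λ d → trans (proj₁ (h d)) (proj₂ (h d)) , sym (proj₂ (h d))))
    (λ h → let h′ = soc-swap v (u ⁻¹) h
           in λ d → trans (proj₁ (h′ d)) (proj₂ (h′ d)) , sym (proj₂ (h′ d)))

  opposite-nilpotent≤2⇔ : NilpotentClass≤2 (opposite B) ⇔ (∀ x → InSoc B _~_ x)
  opposite-nilpotent≤2⇔ = mk⇔ to-soc from-soc ⇔-∘ nilpotent≤2⇔ (opposite B)
    where
    to-soc : (∀ x → InSoc (opposite B) (QRel (opposite B) 1) x) → ∀ x → InSoc B _~_ x
    to-soc soc x c = ~-trans x∘c~cx cx~xc , ~-sym cx~xc
      where
      x∘c~cx : x ∘ c ~ c · x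
      x∘c~cx = to opposite-~⇔ (proj₁ (soc x c))
      cx~xc : c · x ~ x · c
      cx~xc = to opposite-~⇔ (proj₂ (soc x c))
    from-soc : (∀ x → InSoc B _~_ x) → ∀ x → InSoc (opposite B) (QRel (opposite B) 1) x
    from-soc soc x c = from opposite-~⇔ (~-trans (proj₁ (soc x c)) (proj₂ (soc x c))) ,
                       from opposite-~⇔ (~-sym (proj₂ (soc x c)))

theorem6p4 : ∀ {ℓ : Level} (B : SkewBrace ℓ) →
    (TwoReductive (lam B) (rho B) ⇔ ConditionII B) ×
    (TwoReductive (lam B) (rho B) ⇔ MPL≤2 (lam B) (rho B)) ×
    (TwoReductive (lam B) (rho B) ⇔ NilpotentClass≤2 B) ×
    (TwoReductive (lam B) (rho B) ⇔ NilpotentClass≤2 (opposite B))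
theorem6p4 B =
  ⇔-sym conditionII⇔ ⇔-∘ reductive⇔soc ,
  ⇔-sym (mpl≤2⇔trivialRetraction σ τ e σ-e τ-e) ⇔-∘ twoReductive⇔trivialRetraction σ τ ,
  ⇔-sym (nilpotent≤2⇔ B) ⇔-∘ reductive⇔soc ,
  ⇔-sym opposite-nilpotent≤2⇔ ⇔-∘ reductive⇔soc
  where
  open SkewBrace B using (e)
  open Brace B
  reductive⇔soc : TwoReductive σ τ ⇔ (∀ x → InSoc B _~_ x)
  reductive⇔soc = trivialRetraction⇔ ⇔-∘ twoReductive⇔trivialRetraction σ τ
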